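{- The reversal of an extraTrib is not an extraTrib: if $(S_i)_{i\in\mathbb Z}$ is an extraTrib and $R_i=|S_{ -i}|$ for all $i\in\mathbb Z$, then $(R_i)_{i\in\mathbb Z}$ is not an extraTrib.
   Context: An extraTrib is a two-sided integer sequence $(X_i)_{i\in\mathbb Z}$ satisfying $X_i=X_{i-1}+X_{i-2}+X_{i-3}$ for all $i$ and $X_i>0$ for all sufficiently large $i$. -}

module Defs where

open import Data.Integer using (ℤ; +_; -_; _+_; _-_; _≤_; _>_; ∣_∣)
open import Data.Product using (Σ; _×_)
open import Relation.Binary.PropositionalEquality using (_≡_)

IsTribRec : (ℤ → ℤ) → Set
IsTribRec X = ∀ (i : ℤ) → X i ≡ X (i - + 1) + X (i - + 2) + X (i - + 3)

EventuallyPositive : (ℤ → ℤ) → Set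
EventuallyPositive X = Σ ℤ (λ N → ∀ (i : ℤ) → N ≤ i → X i > + 0)

ExtraTrib : (ℤ → ℤ) → Set
ExtraTrib X = IsTribRec X × EventuallyPositive X

absReversal : (ℤ → ℤ) → (ℤ → ℤ)
absReversal S i = + ∣ S (- i) ∣

{-# OPTIONS --safe #-}
module Submission where

-- Let N be such that S is positive from N on, and write a, b, c, d for
-- S N, …, S (N + 3).  The recurrence of S gives d = c + b + a > a.  Read at
-- index -N, the recurrence of the reversal runs forwards in S and, the
-- absolute values being harmless on positive terms, gives a = b + c + d > d.

open import Defs
open import Relation.Nullary using (¬_)
open import Data.Integer using (ℤ; +_; -_; _+_; _-_; _<_; _>_; ∣_∣)
open import Data.Integer.Properties
open import Data.Integer.Tactic.RingSolver using (solve-∀)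
open import Data.Product using (_,_)
open import Relation.Binary.PropositionalEquality

reverse : (ℤ → ℤ) → ℤ → ℤ
reverse X i = X (- i)

IsTribRec⇒step : ∀ {X} → IsTribRec X →
                 ∀ n → X (n + + 3) ≡ X (n + + 2) + X (n + + 1) + X n
IsTribRec⇒step {X} rec n = begin
  X (n + + 3)                                              ≡⟨ rec (n + + 3) ⟩
  X (n + + 3 - + 1) + X (n + + 3 - + 2) + X (n + + 3 - + 3)
    ≡⟨ cong₂ _+_ (cong₂ _+_ (cong X (shift₁ n)) (cong X (shift₂ n))) (cong X (shift₃ n)) ⟩
  X (n + + 2) + X (n + + 1) + X n                          ∎
  where
  open ≡-Reasoning
  shift₁ : ∀ n → n + + 3 - + 1 ≡ n + + 2
  shift₁ = solve-∀
  shift₂ : ∀ n → n + + 3 - + 2 ≡ n + + 1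
  shift₂ = solve-∀
  shift₃ : ∀ n → n + + 3 - + 3 ≡ n
  shift₃ = solve-∀

IsTribRec-reverse⇒backStep : ∀ {X} → IsTribRec (reverse X) →
                             ∀ n → X n ≡ X (n + + 1) + X (n + + 2) + X (n + + 3)
IsTribRec-reverse⇒backStep {X} rec n = begin
  X n                                                       ≡⟨ cong X (neg-involutive n) ⟨
  reverse X (- n)                                           ≡⟨ rec (- n) ⟩
  X (- (- n - + 1)) + X (- (- n - + 2)) + X (- (- n - + 3))
    ≡⟨ cong₂ _+_ (cong₂ _+_ (cong X (flip₁ n)) (cong X (flip₂ n))) (cong X (flip₃ n)) ⟩
  X (n + + 1) + X (n + + 2) + X (n + + 3)                   ∎
  where
  open ≡-Reasoning
  flip₁ : ∀ n → - (- n - + 1) ≡ n + + 1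
  flip₁ = solve-∀
  flip₂ : ∀ n → - (- n - + 2) ≡ n + + 2
  flip₂ = solve-∀
  flip₃ : ∀ n → - (- n - + 3) ≡ n + + 3
  flip₃ = solve-∀

i<j+k+i : ∀ {i j k} → j > + 0 → k > + 0 → i < j + k + i
i<j+k+i {i} {j} {k} j>0 k>0 =
  subst (_< j + k + i) (+-identityˡ i) (+-monoˡ-< i (+-mono-< j>0 k>0))

+∣i∣≡i : ∀ {i} → i > + 0 → + ∣ i ∣ ≡ i
+∣i∣≡i i>0 = 0≤i⇒+∣i∣≡i (<⇒≤ i>0)

mainTheorem19 : ∀ (S : ℤ → ℤ) → ExtraTrib S → ¬ ExtraTrib (absReversal S)
mainTheorem19 S (rec , N , pos) (revRec , _) = <-asym a<d d<a
  where
  open ≡-Reasoning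
  a = S N ; b = S (N + + 1) ; c = S (N + + 2) ; d = S (N + + 3)
  a>0 : a > + 0
  a>0 = pos N ≤-refl
  b>0 : b > + 0
  b>0 = pos _ (i≤i+j N (+ 1))
  c>0 : c > + 0
  c>0 = pos _ (i≤i+j N (+ 2))
  d>0 : d > + 0
  d>0 = pos _ (i≤i+j N (+ 3))
  a<d : a < d
  a<d = subst (a <_) (sym (IsTribRec⇒step rec N)) (i<j+k+i c>0 b>0)
  -- absReversal S is definitionally reverse (λ i → + ∣ S i ∣).
  a≡b+c+d : a ≡ b + c + d
  a≡b+c+d = begin
    a                           ≡⟨ +∣i∣≡i a>0 ⟨
    + ∣ a ∣                     ≡⟨ IsTribRec-reverse⇒backStep revRec N ⟩
    + ∣ b ∣ + + ∣ c ∣ + + ∣ d ∣  ≡⟨ cong₂ _+_ (cong₂ _+_ (+∣i∣≡i b>0) (+∣i∣≡i c>0)) (+∣i∣≡i d>0) ⟩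
    b + c + d                   ∎
  d<a : d < a
  d<a = subst (d <_) (sym a≡b+c+d) (i<j+k+i b>0 c>0)
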